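{- Let $G$ be a finite abelian group of even order, let $\mathcal{B}=(B_1,\dots,B_t)$ be a tuple of largest sum-free sets of $G$, and let $x\in\mathcal{B}(\mathbf{0}_t)$, where $\mathbf{0}_t$ is the zero vector of length $t$. Then for every $\boldsymbol{\varepsilon}\in\{0,1\}^t$ and every $b\in\mathcal{B}(\boldsymbol{\varepsilon})$ we have $x-b\in\mathcal{B}(\boldsymbol{\varepsilon})$.
   Context: A subset of an abelian group is sum-free if it contains no (not necessarily distinct) elements $a,b,c$ with $a+b=c$; a largest sum-free set is a sum-free subset of maximum size. For a largest sum-free set $B$ write $B^1=B$ and $B^0=G\setminus B$. For a tuple $\mathcal{B}=(B_1,\dots,B_t)$ and $\boldsymbol{\varepsilon}=(\varepsilon_1,\dots,\varepsilon_t)\in\{0,1\}^t$, the atom is $\mathcal{B}(\boldsymbol{\varepsilon})=\bigcap_{i=1}^t B_i^{\varepsilon_i}$. -}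

module Defs where

open import Data.Nat using (ℕ; _≤_)
open import Data.Bool using (Bool; true; false)
open import Data.Fin using (Fin)
open import Data.Fin.Subset using (Subset; _∈_; _∉_; ∁; ∣_∣)
open import Data.Product using (_×_)
open import Relation.Binary.PropositionalEquality using (_≡_)
open import Algebra.Structures using (IsAbelianGroup)

-- A finite abelian group of order n, presented on the carrier Fin n
-- (every finite abelian group is isomorphic to such a presentation).
record FinAbGroup (n : ℕ) : Set where
  field
    _+_ : Fin n → Fin n → Fin n
    0#  : Fin n
    -_  : Fin n → Fin n
    isAbelianGroup : IsAbelianGroup _≡_ _+_ 0# -_

  _-_ : Fin n → Fin n → Fin n
  a - b = a + (- b)

module _ {n : ℕ} (G : FinAbGroup n) where
  open FinAbGroup G

  SumFree : Subset n → Set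
  SumFree A = ∀ a b → a ∈ A → b ∈ A → (a + b) ∉ A

  LargestSumFree : Subset n → Set
  LargestSumFree B = SumFree B × (∀ C → SumFree C → ∣ C ∣ ≤ ∣ B ∣)

_^_ : {n : ℕ} → Subset n → Bool → Subset n
B ^ true  = B
B ^ false = ∁ B

_∈Atom_at_ : {n t : ℕ} → Fin n → (Fin t → Subset n) → (Fin t → Bool) → Set
x ∈Atom B at ε = ∀ i → x ∈ (B i ^ ε i)

-- A largest sum-free set B of a group G of even order n has at least n/2 elements.
-- Indeed, some g ≠ 0 has g + g = 0, so the doubling map is not injective, hence not
-- surjective; a proper subgroup H ⊇ 2G of maximum size then has index two (H ∪ (g + H)
-- is again a proper subgroup containing 2G for any g ∉ H, unless it is all of G), and
-- G ∖ H is a sum-free set of size n/2.  Now let c ∈ B and h ∉ B.  Since B is sum-free,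
-- c + B ⊆ G ∖ B, and |c + B| = |B| ≥ |G ∖ B| forces c + B = G ∖ B ∋ h, i.e. h − c ∈ B.
-- This settles the coordinates with εᵢ = 1 (take c = b, h = x); for εᵢ = 0, x − b ∈ Bᵢ
-- would give b = x − (x − b) ∈ Bᵢ.

module Submission where

open import Defs
open import Algebra.Bundles using (AbelianGroup)
import Algebra.Properties.AbelianGroup as AbelianGroupProperties
import Algebra.Properties.CommutativeSemigroup as CommutativeSemigroupProperties
open import Data.Bool using (Bool; true; false)
open import Data.Fin using (Fin; _≟_)
open import Data.Fin.Properties using (any?; all?; ¬∀⟶∃¬)
open import Data.Fin.Subset
  using (Subset; _∈_; _∉_; _⊂_; _─_; ∁; ∣_∣; ⊤; Nonempty; inside; outside) renaming (_-_ to _∖_)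
open import Data.Fin.Subset.Properties
  using ( _∈?_; ∈⊤; ∣⊥∣≡0; ∣⊤∣≡n; ∣p∣≤n; ∣∁p∣≡n∸∣p∣; p─⊥≡p; p─q⊆p; x∉⁅y⁆⇒x≢y
        ; x∈p∧x≢y⇒x∈p-y; x∈p⇒∣p-x∣<∣p∣; p⊂q⇒∣p∣<∣q∣; Empty-unique; nonempty?; anySubset?
        ; x∈∁p⇒x∉p; x∉p⇒x∈∁p; x∉∁p⇒x∈p; x∈p⇒x∉∁p)
open import Data.Nat as ℕ using (ℕ; suc; _*_; _∸_; _≤_; _<_; _<?_; z≤n; s≤s)
open import Data.Nat.Divisibility using (_∣_; divides; ∣-refl; ∣m∣n⇒∣m+n; ∣m+n∣m⇒∣n; ∣1⇒≡1)
open import Data.Nat.Induction using (<-wellFounded)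
open import Data.Nat.Properties
  using (<-trans; <-≤-trans; <⇒≱; ≮⇒≥; ∸-monoʳ-≤; ∸-monoʳ-<; +-comm; *-comm; module ≤-Reasoning)
open import Data.Product using (∃; _×_; _,_; proj₁; proj₂; uncurry)
open import Data.Sum using (_⊎_; inj₁; inj₂)
open import Data.Vec using (_∷_; tabulate; here; there)
open import Data.Vec.Properties using (lookup∘tabulate; lookup⇒[]=; []=⇒lookup)
open import Function using (_∘_)
open import Function.Definitions using (Injective)
open import Induction.WellFounded using (module All)
open import Level using (0ℓ)
open import Relation.Binary.Construct.On as On using ()
open import Relation.Binary.PropositionalEquality
  using (_≡_; _≢_; refl; sym; trans; cong; subst; module ≡-Reasoning)
open import Relation.Nullary using (¬_; yes; no; does; proof; contradiction)
open import Relation.Nullary.Decidable using (dec-true; _×-dec_; _⊎-dec_; _→-dec_; ¬?)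
open import Relation.Nullary.Reflects using (Reflects; invert)
open import Relation.Unary using (Decidable)

private
  variable
    m k : ℕ

x∈p─q⇒x∉q : ∀ {x} (p q : Subset m) → x ∈ p ─ q → x ∉ q
x∈p─q⇒x∉q (inside ∷ p) (outside ∷ q) here ()
x∈p─q⇒x∉q (_ ∷ p) (_ ∷ q) (there x∈p─q) (there x∈q) = x∈p─q⇒x∉q p q x∈p─q x∈q

x∈p∖y⇒x≢y : ∀ {x y} {p : Subset m} → x ∈ p ∖ y → x ≢ y
x∈p∖y⇒x≢y {p = p} x∈p∖y = x∉⁅y⁆⇒x≢y (x∈p─q⇒x∉q p _ x∈p∖y)

x∈p∖y⇒x∈p : ∀ {x y} {p : Subset m} → x ∈ p ∖ y → x ∈ p
x∈p∖y⇒x∈p {p = p} = p─q⊆p p _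

∣p∣≡1+∣p∖x∣ : ∀ {x} {p : Subset m} → x ∈ p → ∣ p ∣ ≡ suc ∣ p ∖ x ∣
∣p∣≡1+∣p∖x∣ {p = inside ∷ p}  here        = cong (suc ∘ ∣_∣) (sym (p─⊥≡p p))
∣p∣≡1+∣p∖x∣ {p = inside ∷ p}  (there x∈p) = cong suc (∣p∣≡1+∣p∖x∣ x∈p)
∣p∣≡1+∣p∖x∣ {p = outside ∷ p} (there x∈p) = ∣p∣≡1+∣p∖x∣ x∈p

¬Nonempty⇒∣p∣≡0 : {p : Subset m} → ¬ Nonempty p → ∣ p ∣ ≡ 0
¬Nonempty⇒∣p∣≡0 {m} empty = trans (cong ∣_∣ (Empty-unique empty)) (∣⊥∣≡0 m)

∣∣-rec : (P : Subset m → Set) → (∀ p → (∀ {q} → ∣ q ∣ < ∣ p ∣ → P q) → P p) → ∀ p → P p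
∣∣-rec = All.wfRec (On.wellFounded ∣_∣ <-wellFounded) 0ℓ

injection⇒∣p∣≤∣q∣ : {f : Fin m → Fin k} → Injective _≡_ _≡_ f →
                    (p : Subset m) {q : Subset k} → (∀ {x} → x ∈ p → f x ∈ q) → ∣ p ∣ ≤ ∣ q ∣
injection⇒∣p∣≤∣q∣ {f = f} f-inj = ∣∣-rec (λ p → ∀ {q} → (∀ {x} → x ∈ p → f x ∈ q) → ∣ p ∣ ≤ ∣ q ∣) step
  where
  open ≤-Reasoning
  step : ∀ p → (∀ {r} → ∣ r ∣ < ∣ p ∣ → ∀ {q} → (∀ {x} → x ∈ r → f x ∈ q) → ∣ r ∣ ≤ ∣ q ∣) →
         ∀ {q} → (∀ {x} → x ∈ p → f x ∈ q) → ∣ p ∣ ≤ ∣ q ∣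
  step p rec {q} f[p]⊆q with nonempty? p
  ... | no empty = begin
    ∣ p ∣ ≡⟨ ¬Nonempty⇒∣p∣≡0 empty ⟩
    0     ≤⟨ z≤n ⟩
    ∣ q ∣ ∎
  ... | yes (x , x∈p) = begin
    ∣ p ∣           ≡⟨ ∣p∣≡1+∣p∖x∣ x∈p ⟩
    suc ∣ p ∖ x ∣   ≤⟨ s≤s (rec (x∈p⇒∣p-x∣<∣p∣ x∈p) f[p∖x]⊆q∖fx) ⟩
    suc ∣ q ∖ f x ∣ ≡⟨ ∣p∣≡1+∣p∖x∣ (f[p]⊆q x∈p) ⟨
    ∣ q ∣           ∎
    where
    f[p∖x]⊆q∖fx : ∀ {y} → y ∈ p ∖ x → f y ∈ q ∖ f x
    f[p∖x]⊆q∖fx y∈p∖x = x∈p∧x≢y⇒x∈p-y (f[p]⊆q (x∈p∖y⇒x∈p y∈p∖x)) (x∈p∖y⇒x≢y y∈p∖x ∘ f-inj)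

fixedPointFree-involution⇒2∣∣p∣ : {ι : Fin m → Fin m} → (∀ x → ι (ι x) ≡ x) → (p : Subset m) →
                                   (∀ {x} → x ∈ p → ι x ∈ p) → (∀ {x} → x ∈ p → ι x ≢ x) → 2 ∣ ∣ p ∣
fixedPointFree-involution⇒2∣∣p∣ {ι = ι} ι-involutive = ∣∣-rec Motive step
  where
  Motive : Subset _ → Set
  Motive p = (∀ {x} → x ∈ p → ι x ∈ p) → (∀ {x} → x ∈ p → ι x ≢ x) → 2 ∣ ∣ p ∣

  ι-injective : ∀ {x y} → ι x ≡ ι y → x ≡ y
  ι-injective {x} {y} e = trans (sym (ι-involutive x)) (trans (cong ι e) (ι-involutive y))

  step : ∀ p → (∀ {q} → ∣ q ∣ < ∣ p ∣ → Motive q) → Motive p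
  step p rec ι[p]⊆p no-fixed with nonempty? p
  ... | no empty = subst (2 ∣_) (sym (¬Nonempty⇒∣p∣≡0 empty)) (divides 0 refl)
  ... | yes (x , x∈p) =
    subst (2 ∣_) (sym ∣p∣≡2+∣p′∣) (∣m∣n⇒∣m+n ∣-refl (rec ∣p′∣<∣p∣ ι[p′]⊆p′ (no-fixed ∘ p′⊆p)))
    where
    ιx∈p∖x : ι x ∈ p ∖ x
    ιx∈p∖x = x∈p∧x≢y⇒x∈p-y (ι[p]⊆p x∈p) (no-fixed x∈p)
    p′ = p ∖ x ∖ ι x
    p′⊆p : ∀ {y} → y ∈ p′ → y ∈ p
    p′⊆p = x∈p∖y⇒x∈p ∘ x∈p∖y⇒x∈p
    ∣p∣≡2+∣p′∣ : ∣ p ∣ ≡ 2 ℕ.+ ∣ p′ ∣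
    ∣p∣≡2+∣p′∣ = trans (∣p∣≡1+∣p∖x∣ x∈p) (cong suc (∣p∣≡1+∣p∖x∣ ιx∈p∖x))
    ∣p′∣<∣p∣ : ∣ p′ ∣ < ∣ p ∣
    ∣p′∣<∣p∣ = <-trans (x∈p⇒∣p-x∣<∣p∣ ιx∈p∖x) (x∈p⇒∣p-x∣<∣p∣ x∈p)
    ι[p′]⊆p′ : ∀ {y} → y ∈ p′ → ι y ∈ p′
    ι[p′]⊆p′ {y} y∈p′ = x∈p∧x≢y⇒x∈p-y (x∈p∧x≢y⇒x∈p-y (ι[p]⊆p (p′⊆p y∈p′)) ιy≢x) ιy≢ιx
      where
      ιy≢x : ι y ≢ x
      ιy≢x ιy≡x = x∈p∖y⇒x≢y y∈p′ (trans (sym (ι-involutive y)) (cong ι ιy≡x))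
      ιy≢ιx : ι y ≢ ι x
      ιy≢ιx = x∈p∖y⇒x≢y (x∈p∖y⇒x∈p y∈p′) ∘ ι-injective

even⇒∃another-fixedPoint : 2 ∣ m → {ι : Fin m → Fin m} → (∀ x → ι (ι x) ≡ x) →
                           ∀ {x} → ι x ≡ x → ∃ λ y → y ≢ x × ι y ≡ y
even⇒∃another-fixedPoint {m} 2∣m {ι} ι-involutive {x} ιx≡x with any? (λ y → ¬? (y ≟ x) ×-dec (ι y ≟ y))
... | yes found = found
... | no none = contradiction (∣1⇒≡1 (∣m+n∣m⇒∣n 2∣∣S∣+1 2∣∣S∣)) λ ()
  where
  S = ⊤ ∖ x
  ι[S]⊆S : ∀ {y} → y ∈ S → ι y ∈ S
  ι[S]⊆S {y} y∈S = x∈p∧x≢y⇒x∈p-y ∈⊤ λ ιy≡x →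
    x∈p∖y⇒x≢y y∈S (trans (sym (ι-involutive y)) (trans (cong ι ιy≡x) ιx≡x))
  2∣∣S∣ : 2 ∣ ∣ S ∣
  2∣∣S∣ = fixedPointFree-involution⇒2∣∣p∣ ι-involutive S ι[S]⊆S
    λ y∈S ιy≡y → none (_ , x∈p∖y⇒x≢y y∈S , ιy≡y)
  2∣∣S∣+1 : 2 ∣ ∣ S ∣ ℕ.+ 1
  2∣∣S∣+1 = subst (2 ∣_) (trans (sym (∣⊤∣≡n m)) (trans (∣p∣≡1+∣p∖x∣ (∈⊤ {x = x})) (+-comm 1 ∣ S ∣))) 2∣m

∃-maximum : {Q : Subset m → Set} → Decidable Q → ∀ {p} → Q p →
            ∃ λ q → Q q × (∀ r → Q r → ∣ r ∣ ≤ ∣ q ∣)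
∃-maximum {m} {Q} Q? {p} = All.wfRec (On.wellFounded (λ p → m ∸ ∣ p ∣) <-wellFounded) 0ℓ Motive step p
  where
  Motive : Subset m → Set
  Motive p = Q p → ∃ λ q → Q q × (∀ r → Q r → ∣ r ∣ ≤ ∣ q ∣)
  step : ∀ p → (∀ {q} → m ∸ ∣ q ∣ < m ∸ ∣ p ∣ → Motive q) → Motive p
  step p rec Qp with anySubset? (λ q → Q? q ×-dec ∣ p ∣ <? ∣ q ∣)
  ... | yes (q , Qq , ∣p∣<∣q∣) = rec (∸-monoʳ-< ∣p∣<∣q∣ (∣p∣≤n q)) Qq
  ... | no no-larger = p , Qp , λ r Qr → ≮⇒≥ (λ ∣p∣<∣r∣ → no-larger (r , Qr , ∣p∣<∣r∣))

injective⇒surjective : {f : Fin m → Fin m} → Injective _≡_ _≡_ f → ∀ y → ∃ λ x → f x ≡ y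
injective⇒surjective {m} {f} f-inj y with any? (λ x → f x ≟ y)
... | yes hit = hit
... | no miss = contradiction (injection⇒∣p∣≤∣q∣ f-inj ⊤ f[⊤]⊆⊤∖y) (<⇒≱ (x∈p⇒∣p-x∣<∣p∣ (∈⊤ {x = y})))
  where
  f[⊤]⊆⊤∖y : ∀ {x} → x ∈ ⊤ → f x ∈ ⊤ ∖ y
  f[⊤]⊆⊤∖y {x} _ = x∈p∧x≢y⇒x∈p-y ∈⊤ (miss ∘ (x ,_))

surjective⇒injective : {f : Fin m → Fin m} → (∀ y → ∃ λ x → f x ≡ y) → Injective _≡_ _≡_ f
surjective⇒injective {f = f} surj {x} {x′} fx≡fx′ = begin
  x      ≡⟨ proj₂ (s-surj x) ⟨
  s y    ≡⟨ cong s y≡y′ ⟩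
  s y′   ≡⟨ proj₂ (s-surj x′) ⟩
  x′     ∎
  where
  open ≡-Reasoning
  s : Fin _ → Fin _
  s = proj₁ ∘ surj
  f∘s≡id : ∀ y → f (s y) ≡ y
  f∘s≡id = proj₂ ∘ surj
  s-surj : ∀ x → ∃ λ y → s y ≡ x
  s-surj = injective⇒surjective λ {y} {y′} sy≡sy′ →
    trans (sym (f∘s≡id y)) (trans (cong f sy≡sy′) (f∘s≡id y′))
  y = proj₁ (s-surj x)
  y′ = proj₁ (s-surj x′)
  y≡y′ : y ≡ y′
  y≡y′ = begin
    y         ≡⟨ f∘s≡id y ⟨
    f (s y)   ≡⟨ cong f (proj₂ (s-surj x)) ⟩
    f x       ≡⟨ fx≡fx′ ⟩
    f x′      ≡⟨ cong f (proj₂ (s-surj x′)) ⟨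
    f (s y′)  ≡⟨ f∘s≡id y′ ⟩
    y′        ∎

subset : {P : Fin m → Set} → Decidable P → Subset m
subset P? = tabulate (does ∘ P?)

∈subset⁺ : {P : Fin m → Set} (P? : Decidable P) → ∀ {x} → P x → x ∈ subset P?
∈subset⁺ P? {x} Px = lookup⇒[]= x _ (trans (lookup∘tabulate _ x) (dec-true (P? x) Px))

∈subset⁻ : {P : Fin m → Set} (P? : Decidable P) → ∀ {x} → x ∈ subset P? → P x
∈subset⁻ {P = P} P? {x} x∈ = invert (subst (Reflects (P x)) does≡true (proof (P? x)))
  where
  does≡true : does (P? x) ≡ true
  does≡true = trans (sym (lookup∘tabulate _ x)) ([]=⇒lookup x∈)

module _ {n : ℕ} (G : FinAbGroup n) where
  open FinAbGroup G

  private
    abelianGroup : AbelianGroup 0ℓ 0ℓ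
    abelianGroup = record
      { Carrier = Fin n ; _≈_ = _≡_ ; _∙_ = _+_ ; ε = 0# ; _⁻¹ = -_ ; isAbelianGroup = isAbelianGroup }

  open AbelianGroup abelianGroup using (comm; identityˡ; identityʳ; inverseʳ; commutativeSemigroup)
  open AbelianGroupProperties abelianGroup
    using (⁻¹-involutive; ε⁻¹≈ε; ⁻¹-∙-comm; ⁻¹-anti-homo‿-; xyx⁻¹≈y
          ; //-rightDividesˡ; //-rightDividesʳ; ∙-cancelˡ)
  open CommutativeSemigroupProperties commutativeSemigroup using (interchange; xy∙z≈xz∙y)

  [a-b]-[c-d]≡[a-c]-[b-d] : ∀ a b c d → (a - b) - (c - d) ≡ (a - c) - (b - d)
  [a-b]-[c-d]≡[a-c]-[b-d] a b c d = begin
    (a - b) - (c - d)                   ≡⟨ cong ((a - b) +_) (⁻¹-∙-comm c (- d)) ⟨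
    (a + (- b)) + ((- c) + (- (- d)))   ≡⟨ interchange a (- b) (- c) (- (- d)) ⟩
    (a + (- c)) + ((- b) + (- (- d)))   ≡⟨ cong ((a - c) +_) (⁻¹-∙-comm b (- d)) ⟩
    (a - c) - (b - d)                   ∎
    where open ≡-Reasoning

  [a-g]-[b-g]≡a-b : ∀ a b g → (a - g) - (b - g) ≡ a - b
  [a-g]-[b-g]≡a-b a b g = begin
    (a - g) - (b - g) ≡⟨ [a-b]-[c-d]≡[a-c]-[b-d] a g b g ⟩
    (a - b) - (g - g) ≡⟨ cong (λ z → (a - b) - z) (inverseʳ g) ⟩
    (a - b) - 0#      ≡⟨ cong ((a - b) +_) ε⁻¹≈ε ⟩
    (a - b) + 0#      ≡⟨ identityʳ (a - b) ⟩
    a - b             ∎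
    where open ≡-Reasoning

  [a+a]-[b+b]≡[a-b]+[a-b] : ∀ a b → (a + a) - (b + b) ≡ (a - b) + (a - b)
  [a+a]-[b+b]≡[a-b]+[a-b] a b =
    trans (cong ((a + a) +_) (sym (⁻¹-∙-comm b b))) (interchange a a (- b) (- b))

  x-[x-y]≡y : ∀ x y → x - (x - y) ≡ y
  x-[x-y]≡y x y = begin
    x - (x - y)   ≡⟨ cong (x +_) (⁻¹-anti-homo‿- x y) ⟩
    x + (y - x)   ≡⟨ comm x (y - x) ⟩
    (y - x) + x   ≡⟨ //-rightDividesˡ x y ⟩
    y             ∎
    where open ≡-Reasoning

  even-order⇒∃order-two : 2 ∣ n → ∃ λ g → g ≢ 0# × g + g ≡ 0#
  even-order⇒∃order-two 2∣n with even⇒∃another-fixedPoint 2∣n ⁻¹-involutive ε⁻¹≈ε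
  ... | g , g≢0 , -g≡g = g , g≢0 , trans (cong (g +_) (sym -g≡g)) (inverseʳ g)

  double? : Decidable (λ y → ∃ λ a → a + a ≡ y)
  double? y = any? (λ a → a + a ≟ y)

  even-order⇒∃non-double : 2 ∣ n → ∃ λ y → ∀ a → a + a ≢ y
  even-order⇒∃non-double 2∣n with all? double? | even-order⇒∃order-two 2∣n
  ... | yes every-double | g , g≢0 , g+g≡0 =
    contradiction (surjective⇒injective every-double (trans g+g≡0 (sym (identityˡ 0#)))) g≢0
  ... | no ¬every-double | _ with ¬∀⟶∃¬ n _ double? ¬every-double
  ...   | y , ¬double = y , λ a a+a≡y → ¬double (a , a+a≡y)

  SubtractionClosed : Subset n → Set
  SubtractionClosed H = ∀ a b → a ∈ H → b ∈ H → a - b ∈ H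

  ContainsDoubles : Subset n → Set
  ContainsDoubles H = ∀ a → a + a ∈ H

  ProperSubgroup⊇2G : Subset n → Set
  ProperSubgroup⊇2G H = SubtractionClosed H × ContainsDoubles H × ∃ (_∉ H)

  properSubgroup⊇2G? : Decidable ProperSubgroup⊇2G
  properSubgroup⊇2G? H =
    all? (λ a → all? λ b → a ∈? H →-dec (b ∈? H →-dec (a - b) ∈? H))
    ×-dec all? (λ a → (a + a) ∈? H)
    ×-dec any? (λ g → ¬? (g ∈? H))

  doubles : Subset n
  doubles = subset double?

  doubles-properSubgroup⊇2G : 2 ∣ n → ProperSubgroup⊇2G doubles
  doubles-properSubgroup⊇2G 2∣n with even-order⇒∃non-double 2∣n
  ... | y , ¬double = closed , (λ a → ∈subset⁺ double? (a , refl)) , y , uncurry ¬double ∘ ∈subset⁻ double?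
    where
    closed : SubtractionClosed doubles
    closed _ _ a∈ b∈ with ∈subset⁻ double? a∈ | ∈subset⁻ double? b∈
    ... | x , refl | y , refl = ∈subset⁺ double? (x - y , sym ([a+a]-[b+b]≡[a-b]+[a-b] x y))

  adjoin : Subset n → Fin n → Subset n
  adjoin H g = subset (λ x → x ∈? H ⊎-dec (x - g) ∈? H)

  ∈adjoin⁺ : ∀ {H g x} → x ∈ H ⊎ x - g ∈ H → x ∈ adjoin H g
  ∈adjoin⁺ {H} {g} = ∈subset⁺ (λ x → x ∈? H ⊎-dec (x - g) ∈? H)

  ∈adjoin⁻ : ∀ {H g x} → x ∈ adjoin H g → x ∈ H ⊎ x - g ∈ H
  ∈adjoin⁻ {H} {g} = ∈subset⁻ (λ x → x ∈? H ⊎-dec (x - g) ∈? H)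

  module _ {H : Subset n} (closed : SubtractionClosed H) where

    adjoin-subtractionClosed : ∀ {g} → g + g ∈ H → SubtractionClosed (adjoin H g)
    adjoin-subtractionClosed {g} g+g∈H a b a∈ b∈ with ∈adjoin⁻ a∈ | ∈adjoin⁻ b∈
    ... | inj₁ a∈H   | inj₁ b∈H   = ∈adjoin⁺ (inj₁ (closed a b a∈H b∈H))
    ... | inj₂ a-g∈H | inj₂ b-g∈H =
      ∈adjoin⁺ (inj₁ (subst (_∈ H) ([a-g]-[b-g]≡a-b a b g) (closed _ _ a-g∈H b-g∈H)))
    ... | inj₂ a-g∈H | inj₁ b∈H   =
      ∈adjoin⁺ (inj₂ (subst (_∈ H) (xy∙z≈xz∙y a (- g) (- b)) (closed _ _ a-g∈H b∈H)))
    ... | inj₁ a∈H   | inj₂ b-g∈H =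
      ∈adjoin⁺ (inj₂ (subst (_∈ H) [a-2g]-[b-g]≡[a-b]-g (closed _ _ (closed _ _ a∈H g+g∈H) b-g∈H)))
      where
      open ≡-Reasoning
      [a-2g]-[b-g]≡[a-b]-g : (a - (g + g)) - (b - g) ≡ (a - b) - g
      [a-2g]-[b-g]≡[a-b]-g = begin
        (a - (g + g)) - (b - g) ≡⟨ [a-b]-[c-d]≡[a-c]-[b-d] a (g + g) b g ⟩
        (a - b) - ((g + g) - g) ≡⟨ cong (λ z → (a - b) - z) (//-rightDividesʳ g g) ⟩
        (a - b) - g             ∎

  maximal⇒∁H-g⊆H : ∀ {H} → ProperSubgroup⊇2G H → (∀ K → ProperSubgroup⊇2G K → ∣ K ∣ ≤ ∣ H ∣) →
                  ∀ {g} → g ∉ H → ∀ {a} → a ∉ H → a - g ∈ H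
  maximal⇒∁H-g⊆H {H} (closed , doubles∈H , _) maximal {g} g∉H {a} a∉H with a ∈? adjoin H g
  ... | no a∉K = contradiction (maximal (adjoin H g) K-proper) (<⇒≱ (p⊂q⇒∣p∣<∣q∣ H⊂K))
    where
    K-proper : ProperSubgroup⊇2G (adjoin H g)
    K-proper = adjoin-subtractionClosed closed (doubles∈H g) , ∈adjoin⁺ ∘ inj₁ ∘ doubles∈H , a , a∉K
    g-g∈H : g - g ∈ H
    g-g∈H = subst (_∈ H) (trans (identityˡ 0#) (sym (inverseʳ g))) (doubles∈H 0#)
    H⊂K : H ⊂ adjoin H g
    H⊂K = ∈adjoin⁺ ∘ inj₁ , g , ∈adjoin⁺ (inj₂ g-g∈H) , g∉H
  ... | yes a∈K with ∈adjoin⁻ a∈K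
  ...   | inj₁ a∈H   = contradiction a∈H a∉H
  ...   | inj₂ a-g∈H = a-g∈H

  module _ {H : Subset n} (closed : SubtractionClosed H) {g} (g∉H : g ∉ H)
           (∁H-g⊆H : ∀ {a} → a ∉ H → a - g ∈ H) where

    ∁-sumFree : SumFree G (∁ H)
    ∁-sumFree a b a∈∁H b∈∁H = x∈p⇒x∉∁p (subst (_∈ H) (cong (a +_) (⁻¹-involutive b)) a+b∈H)
      where
      a∉H = x∈∁p⇒x∉p a∈∁H
      b∉H = x∈∁p⇒x∉p b∈∁H
      0∈H : 0# ∈ H
      0∈H = subst (_∈ H) (inverseʳ (g - g)) (closed _ _ (∁H-g⊆H g∉H) (∁H-g⊆H g∉H))
      -b∉H : - b ∉ H
      -b∉H -b∈H = b∉H (subst (_∈ H) (trans (identityˡ _) (⁻¹-involutive b)) (closed _ _ 0∈H -b∈H))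
      a+b∈H : a - (- b) ∈ H
      a+b∈H = subst (_∈ H) ([a-g]-[b-g]≡a-b a (- b) g) (closed _ _ (∁H-g⊆H a∉H) (∁H-g⊆H -b∉H))

    -- i.e. ∣ H ∣ ≤ ∣ ∁ H ∣, in the form ∣ ∁ C ∣ ≤ ∣ C ∣ needed for C = ∁ H
    ∣∁∁H∣≤∣∁H∣ : ∣ ∁ (∁ H) ∣ ≤ ∣ ∁ H ∣
    ∣∁∁H∣≤∣∁H∣ = injection⇒∣p∣≤∣q∣ (∙-cancelˡ g _ _) (∁ (∁ H)) g+x∈∁H
      where
      g+x∈∁H : ∀ {x} → x ∈ ∁ (∁ H) → g + x ∈ ∁ H
      g+x∈∁H {x} x∈∁∁H = x∉p⇒x∈∁p λ g+x∈H →
        g∉H (subst (_∈ H) (//-rightDividesʳ x g) (closed _ _ g+x∈H (x∉∁p⇒x∈p (x∈∁p⇒x∉p x∈∁∁H))))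

  even-order⇒∃large-sumFree : 2 ∣ n → ∃ λ C → SumFree G C × ∣ ∁ C ∣ ≤ ∣ C ∣
  even-order⇒∃large-sumFree 2∣n with ∃-maximum properSubgroup⊇2G? (doubles-properSubgroup⊇2G 2∣n)
  ... | M , M-proper@(closed , _ , g , g∉M) , maximal =
    ∁ M , ∁-sumFree closed g∉M ∁H-g⊆H , ∣∁∁H∣≤∣∁H∣ closed g∉M ∁H-g⊆H
    where
    ∁H-g⊆H : ∀ {a} → a ∉ M → a - g ∈ M
    ∁H-g⊆H = maximal⇒∁H-g⊆H M-proper maximal g∉M

  largestSumFree⇒∣∁B∣≤∣B∣ : 2 ∣ n → ∀ {B} → LargestSumFree G B → ∣ ∁ B ∣ ≤ ∣ B ∣
  largestSumFree⇒∣∁B∣≤∣B∣ 2∣n {B} (_ , largest) = from-large (even-order⇒∃large-sumFree 2∣n)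
    where
    open ≤-Reasoning
    from-large : (∃ λ C → SumFree G C × ∣ ∁ C ∣ ≤ ∣ C ∣) → ∣ ∁ B ∣ ≤ ∣ B ∣
    from-large (C , C-sumFree , ∣∁C∣≤∣C∣) = begin
      ∣ ∁ B ∣   ≡⟨ ∣∁p∣≡n∸∣p∣ B ⟩
      n ∸ ∣ B ∣ ≤⟨ ∸-monoʳ-≤ n ∣C∣≤∣B∣ ⟩
      n ∸ ∣ C ∣ ≡⟨ ∣∁p∣≡n∸∣p∣ C ⟨
      ∣ ∁ C ∣   ≤⟨ ∣∁C∣≤∣C∣ ⟩
      ∣ C ∣     ≤⟨ ∣C∣≤∣B∣ ⟩
      ∣ B ∣     ∎
      where
      ∣C∣≤∣B∣ : ∣ C ∣ ≤ ∣ B ∣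
      ∣C∣≤∣B∣ = largest C C-sumFree

  sumFree∧∣∁B∣≤∣B∣⇒∁B-B⊆B : ∀ {B} → SumFree G B → ∣ ∁ B ∣ ≤ ∣ B ∣ →
                            ∀ {c h} → c ∈ B → h ∉ B → h - c ∈ B
  sumFree∧∣∁B∣≤∣B∣⇒∁B-B⊆B {B} sumFree ∣∁B∣≤∣B∣ {c} {h} c∈B h∉B with (h - c) ∈? B
  ... | yes h-c∈B = h-c∈B
  ... | no h-c∉B = contradiction (injection⇒∣p∣≤∣q∣ (∙-cancelˡ c _ _) B c+B⊆∁B∖h)
                                 (<⇒≱ (<-≤-trans (x∈p⇒∣p-x∣<∣p∣ (x∉p⇒x∈∁p h∉B)) ∣∁B∣≤∣B∣))
    where
    c+B⊆∁B∖h : ∀ {x} → x ∈ B → c + x ∈ ∁ B ∖ h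
    c+B⊆∁B∖h {x} x∈B = x∈p∧x≢y⇒x∈p-y (x∉p⇒x∈∁p (sumFree c x c∈B x∈B))
      λ c+x≡h → h-c∉B (subst (λ y → y - c ∈ B) c+x≡h (subst (_∈ B) (sym (xyx⁻¹≈y c x)) x∈B))

  largestSumFree⇒∁B-B⊆B : 2 ∣ n → ∀ {B} → LargestSumFree G B → ∀ {c h} → c ∈ B → h ∉ B → h - c ∈ B
  largestSumFree⇒∁B-B⊆B 2∣n B-largest =
    sumFree∧∣∁B∣≤∣B∣⇒∁B-B⊆B (proj₁ B-largest) (largestSumFree⇒∣∁B∣≤∣B∣ 2∣n B-largest)

  largestSumFree⇒x-[B^e]⊆B^e : 2 ∣ n → ∀ {B} → LargestSumFree G B → ∀ {x} → x ∉ B →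
                                 ∀ e {b} → b ∈ B ^ e → x - b ∈ B ^ e
  largestSumFree⇒x-[B^e]⊆B^e 2∣n B-largest x∉B true b∈B = largestSumFree⇒∁B-B⊆B 2∣n B-largest b∈B x∉B
  largestSumFree⇒x-[B^e]⊆B^e 2∣n {B} B-largest {x} x∉B false {b} b∈∁B = x∉p⇒x∈∁p λ x-b∈B →
    x∈∁p⇒x∉p b∈∁B (subst (_∈ B) (x-[x-y]≡y x b) (largestSumFree⇒∁B-B⊆B 2∣n B-largest x-b∈B x∉B))

lemma3p8 : (n : ℕ) → (G : FinAbGroup n) → ∃ (λ k → n ≡ 2 * k) →
    (t : ℕ) → (B : Fin t → Subset n) → (∀ i → LargestSumFree G (B i)) →
    (x : Fin n) → x ∈Atom B at (λ _ → false) →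
    (ε : Fin t → Bool) → (b : Fin n) → b ∈Atom B at ε →
    FinAbGroup._-_ G x b ∈Atom B at ε
lemma3p8 n G (k , n≡2k) t B largest x x∈B⁰ ε b b∈Bε i =
  largestSumFree⇒x-[B^e]⊆B^e G 2∣n (largest i) (x∈∁p⇒x∉p (x∈B⁰ i)) (ε i) (b∈Bε i)
  where
  2∣n : 2 ∣ n
  2∣n = divides k (trans n≡2k (*-comm 2 k))
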